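{- Let $n\ge2$, $\mathbf{b}\in\{0,1\}^{n-2}$ with $b_i=0$, and let $\mathbf{b}'$ be obtained from $\mathbf{b}$ by changing the $i$-th entry to $1$. Let $(p,q)$ be the unique edge of $G_{\mathbf{b}}$ with $p<i+1<i+2<q$. Let $G'$ be obtained from $G_{\mathbf{b}}$ by interchanging the (non-spine) edge $(i+1,i+2)$ and $(p,q)$, i.e. replacing them by $(p,i+2)$ and $(i+1,q)$. Then $G'=G_{\mathbf{b}'}$.
   Context: For $\mathbf{b}\in\{0,1\}^{n-2}$ with $\{i:b_i=1\}=\{j_1<\dots<j_r\}$, $G_{\mathbf{b}}$ is the DAG on vertex set $[n+1]$ whose edge multiset consists of: the edges $(i,i+1)$ for $i\in[n]$; additional copies of $(1,2)$ and $(n,n+1)$; an additional copy of $(l+1,l+2)$ for each $l\in[n-2]$ with $b_l=0$; and the edges $(1,j_1+2),(j_1+1,j_2+2),\dots,(j_{r-1}+1,j_r+2),(j_r+1,n+1)$ (just $(1,n+1)$ if $r=0$). DAGs are identified with their edge multisets. When $b_i=0$, $G_{\mathbf{b}}$ has exactly one edge $(p,q)$ with $p<i+1<i+2<q$. -}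

module Defs where

open import Data.Nat using (ℕ; zero; suc; _+_)
open import Data.Bool using (Bool; true; false)
open import Data.Product using (_×_; _,_)
open import Data.List using (List; []; _∷_; _++_; map; upTo)
open import Data.Vec using (Vec; []; _∷_)

-- A DAG on vertex set [n+1] is identified with its edge multiset,
-- represented as a list of edges (p , q) compared up to permutation (_↭_).
Edge : Set
Edge = ℕ × ℕ

spine : ℕ → List Edge
spine n = map (λ k → (suc k , suc (suc k))) (upTo n)

ones : ℕ → {m : ℕ} → Vec Bool m → List ℕ
ones k [] = []
ones k (true ∷ bs) = k ∷ ones (suc k) bs
ones k (false ∷ bs) = ones (suc k) bs

zeroEdges : ℕ → {m : ℕ} → Vec Bool m → List Edge
zeroEdges k [] = []
zeroEdges k (true ∷ bs) = zeroEdges (suc k) bs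
zeroEdges k (false ∷ bs) = (suc k , suc (suc k)) ∷ zeroEdges (suc k) bs

chords : ℕ → ℕ → List ℕ → List Edge
chords n s [] = (s , suc n) ∷ []
chords n s (j ∷ js) = (s , j + 2) ∷ chords n (suc j) js

G : (n : ℕ) → Vec Bool (n Data.Nat.∸ 2) → List Edge
G n b = spine n ++ ((1 , 2) ∷ (n , suc n) ∷ (zeroEdges 1 b ++ chords n 1 (ones 1 b)))

-- Put y = i+1, so b_i = 0 contributes an extra copy of the step edge (y , y+1).
-- The chords of G_b before position i end at or before y+1 and those after it
-- start at or after y, so exactly one chord (a , c) straddles (y , y+1).
-- Setting b_i = 1 removes the extra (y , y+1) and splits that chord into
-- (a , y+1) and (y , c), leaving all other edges unchanged.  As no other edge
-- of G_b straddles (y , y+1), the edge (p , q) of the statement is that chord.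
module Submission where

open import Defs
open import Data.Nat using (ℕ; suc; _+_; _∸_; _≤_; _<_; s≤s; s≤s⁻¹)
open import Data.Nat.Properties
  using (+-suc; +-comm; ≤-refl; ≤-trans; n≤1+n; m≤n⇒m≤1+n; m≤n+m; <⇒≤; <⇒≱; <-asym)
open import Data.Bool using (Bool; true; false)
open import Data.Empty using (⊥-elim)
open import Data.Product using (_×_; _,_; proj₁)
open import Data.Fin using (Fin; toℕ; zero; suc)
open import Data.Vec using (Vec; lookup; _[_]≔_; []; _∷_)
open import Data.List using (List; []; _∷_; _++_; upTo)
open import Data.List.Relation.Unary.All as All using (All; []; _∷_)
open import Data.List.Relation.Unary.All.Properties using (++⁺; map⁺)
open import Data.List.Relation.Unary.Any using (here; there)
open import Data.List.Relation.Binary.Permutation.Propositional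
  using (_↭_; ↭-prep; ↭-trans; ↭-sym)
open import Data.List.Relation.Binary.Permutation.Propositional.Properties
  using (shift; shifts; drop-∷; ∈-resp-↭)
open import Function using (_∘_)
open import Relation.Nullary using (¬_)
open import Relation.Binary.PropositionalEquality using (_≡_; refl; subst)

↭-head-unique : ∀ {a p} {A : Set a} {P : A → Set p} {x y : A} {xs ys : List A} →
                All (¬_ ∘ P) xs → P y → x ∷ xs ↭ y ∷ ys → x ≡ y × xs ↭ ys
↭-head-unique none Py x∷xs↭y∷ys with ∈-resp-↭ (↭-sym x∷xs↭y∷ys) (here refl)
... | here refl = refl , drop-∷ x∷xs↭y∷ys
... | there y∈xs = ⊥-elim (All.lookup none y∈xs Py)

Straddles : ℕ → Edge → Set
Straddles y (a , c) = a < y × suc y < c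

¬straddles-source : ∀ {y a c} → y ≤ a → ¬ Straddles y (a , c)
¬straddles-source y≤a (a<y , _) = <⇒≱ a<y y≤a

¬straddles-target : ∀ {y a c} → c ≤ suc y → ¬ Straddles y (a , c)
¬straddles-target c≤1+y (_ , 1+y<c) = <⇒≱ 1+y<c c≤1+y

¬straddles-step : ∀ y a → ¬ Straddles y (a , suc a)
¬straddles-step y a (a<y , 1+y<1+a) = <-asym a<y (s≤s⁻¹ 1+y<1+a)

zeroEdges-¬straddle : ∀ y k {m} (b : Vec Bool m) → All (¬_ ∘ Straddles y) (zeroEdges k b)
zeroEdges-¬straddle y k [] = []
zeroEdges-¬straddle y k (true ∷ b) = zeroEdges-¬straddle y (suc k) b
zeroEdges-¬straddle y k (false ∷ b) = ¬straddles-step y (suc k) ∷ zeroEdges-¬straddle y (suc k) b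

spine-¬straddle : ∀ y n → All (¬_ ∘ Straddles y) (spine n)
spine-¬straddle y n = map⁺ (All.universal (λ k → ¬straddles-step y (suc k)) (upTo n))

ones-≥ : ∀ k {m} (b : Vec Bool m) → All (k ≤_) (ones k b)
ones-≥ k [] = []
ones-≥ k (true ∷ b) = ≤-refl ∷ All.map <⇒≤ (ones-≥ (suc k) b)
ones-≥ k (false ∷ b) = All.map <⇒≤ (ones-≥ (suc k) b)

record Swappable (y : ℕ) (L L′ : List Edge) : Set where
  field
    a c : ℕ
    R : List Edge
    before : L ↭ (y , suc y) ∷ (a , c) ∷ R
    after : L′ ↭ (a , suc y) ∷ (y , c) ∷ R
    others-¬straddle : All (¬_ ∘ Straddles y) R

swappable-↭ : ∀ {y L₁ L₂ L₁′ L₂′} → L₁ ↭ L₂ → L₁′ ↭ L₂′ →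
              Swappable y L₂ L₂′ → Swappable y L₁ L₁′
swappable-↭ L₁↭L₂ L₁′↭L₂′ s = record
  { Swappable s
  ; before = ↭-trans L₁↭L₂ before
  ; after = ↭-trans L₁′↭L₂′ after
  }
  where open Swappable s

swappable-∷ : ∀ {y L L′ e} → ¬ Straddles y e → Swappable y L L′ →
              Swappable y (e ∷ L) (e ∷ L′)
swappable-∷ {e = e} e-ok s = record
  { Swappable s
  ; R = e ∷ R
  ; before = ↭-trans (↭-prep e before) (↭-sym (shift e (_ ∷ _ ∷ []) R))
  ; after = ↭-trans (↭-prep e after) (↭-sym (shift e (_ ∷ _ ∷ []) R))
  ; others-¬straddle = e-ok ∷ others-¬straddle
  }
  where open Swappable s

swappable-++ : ∀ {y L L′} P → All (¬_ ∘ Straddles y) P → Swappable y L L′ →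
               Swappable y (P ++ L) (P ++ L′)
swappable-++ [] [] s = s
swappable-++ (e ∷ P) (e-ok ∷ P-ok) s = swappable-∷ e-ok (swappable-++ P P-ok s)

swappable-+-suc : ∀ {x k L L′} → Swappable (x + suc k) L L′ → Swappable (suc (x + k)) L L′
swappable-+-suc {x} {k} {L} {L′} = subst (λ y → Swappable y L L′) (+-suc x k)

swappable-unique : ∀ {y L L′ p q rest} → Swappable y L L′ → Straddles y (p , q) →
                   L ↭ (y , suc y) ∷ (p , q) ∷ rest →
                   (p , suc y) ∷ (y , q) ∷ rest ↭ L′
swappable-unique s pq-straddles L↭
  with ↭-head-unique (Swappable.others-¬straddle s) pq-straddles
                     (drop-∷ (↭-trans (↭-sym (Swappable.before s)) L↭))
... | refl , R↭rest = ↭-sym (↭-trans (Swappable.after s) (↭-prep _ (↭-prep _ R↭rest)))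

module _ (n : ℕ) where

  extraEdges : ℕ → ℕ → ∀ {m} → Vec Bool m → List Edge
  extraEdges k s b = zeroEdges k b ++ chords n s (ones k b)

  firstChordTarget : List ℕ → ℕ
  firstChordTarget [] = suc n
  firstChordTarget (j ∷ js) = j + 2

  laterChords : List ℕ → List Edge
  laterChords [] = []
  laterChords (j ∷ js) = chords n (suc j) js

  chords-unfold : ∀ s js → chords n s js ≡ (s , firstChordTarget js) ∷ laterChords js
  chords-unfold s [] = refl
  chords-unfold s (j ∷ js) = refl

  chords-sources-≥ : ∀ {t} s js → t ≤ s → All (t ≤_) js → All ((t ≤_) ∘ proj₁) (chords n s js)
  chords-sources-≥ s [] t≤s [] = t≤s ∷ []
  chords-sources-≥ s (j ∷ js) t≤s (t≤j ∷ t≤js) =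
    t≤s ∷ chords-sources-≥ (suc j) js (m≤n⇒m≤1+n t≤j) t≤js

  laterChords-sources-≥ : ∀ {t} js → All (t ≤_) js → All ((t ≤_) ∘ proj₁) (laterChords js)
  laterChords-sources-≥ [] [] = []
  laterChords-sources-≥ (j ∷ js) (t≤j ∷ t≤js) = chords-sources-≥ (suc j) js (m≤n⇒m≤1+n t≤j) t≤js

  swappable-at-first-zero : ∀ k s {m} (b : Vec Bool m) →
                            Swappable (suc k) (extraEdges k s (false ∷ b)) (extraEdges k s (true ∷ b))
  swappable-at-first-zero k s b
    rewrite chords-unfold s (ones (suc k) b) | chords-unfold (suc k) (ones (suc k) b) | +-comm k 2
    = record
    { a = s
    ; c = firstChordTarget (ones (suc k) b)
    ; R = zeroEdges (suc k) b ++ laterChords (ones (suc k) b)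
    ; before = ↭-prep _ (shift _ (zeroEdges (suc k) b) _)
    ; after = shifts (zeroEdges (suc k) b) (_ ∷ _ ∷ [])
    ; others-¬straddle =
        ++⁺ (zeroEdges-¬straddle _ (suc k) b)
            (All.map ¬straddles-source (laterChords-sources-≥ _ (ones-≥ (suc k) b)))
    }

  first-chord-shift : ∀ k s {m} (b : Vec Bool m) →
                      extraEdges k s (true ∷ b) ↭ (s , k + 2) ∷ extraEdges (suc k) (suc k) b
  first-chord-shift k s b = shift _ (zeroEdges (suc k) b) _

  swappable-at : ∀ k s {m} (b : Vec Bool m) (i : Fin m) → lookup b i ≡ false →
                 Swappable (toℕ i + suc k) (extraEdges k s b) (extraEdges k s (b [ i ]≔ true))
  swappable-at k s (true ∷ b) zero ()
  swappable-at k s (false ∷ b) zero refl = swappable-at-first-zero k s b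
  swappable-at k s (false ∷ b) (suc i) b[i]≡0 =
    swappable-∷ (¬straddles-step _ (suc k)) (swappable-+-suc (swappable-at (suc k) s b i b[i]≡0))
  swappable-at k s (true ∷ b) (suc i) b[i]≡0 =
    swappable-↭ (first-chord-shift k s b) (first-chord-shift k s (b [ i ]≔ true))
      (swappable-∷ (¬straddles-target chord-ends-early)
        (swappable-+-suc (swappable-at (suc k) (suc k) b i b[i]≡0)))
    where
    chord-ends-early : k + 2 ≤ suc (suc (toℕ i + suc k))
    chord-ends-early = subst (_≤ suc (suc (toℕ i + suc k))) (+-comm 2 k)
                             (s≤s (s≤s (≤-trans (n≤1+n k) (m≤n+m (suc k) (toℕ i)))))

swappable-G : ∀ n (b : Vec Bool (n ∸ 2)) (i : Fin (n ∸ 2)) → lookup b i ≡ false →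
              Swappable (toℕ i + 2) (G n b) (G n (b [ i ]≔ true))
swappable-G n b i b[i]≡0 =
  swappable-++ (spine n) (spine-¬straddle _ n)
    (swappable-∷ (¬straddles-step _ 1)
      (swappable-∷ (¬straddles-step _ n) (swappable-at n 1 1 b i b[i]≡0)))

lemma3p19 : (n : ℕ) → 2 ≤ n → (b : Vec Bool (n ∸ 2)) → (i : Fin (n ∸ 2)) →
    lookup b i ≡ false →
    (p q : ℕ) → p < toℕ i + 2 → toℕ i + 3 < q →
    (rest : List Edge) →
    G n b ↭ ((toℕ i + 2 , toℕ i + 3) ∷ (p , q) ∷ rest) →
    ((p , toℕ i + 3) ∷ (toℕ i + 2 , q) ∷ rest) ↭ G n (b [ i ]≔ true)
lemma3p19 n _ b i b[i]≡0 p q p<i+2 i+3<q rest G↭ rewrite +-suc (toℕ i) 2 =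
  swappable-unique (swappable-G n b i b[i]≡0) (p<i+2 , i+3<q) G↭
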